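{- Let $G$ be a strongly connected directed graph and let $e=(u,v)$ be a strong bridge of $G$. Two vertices are strongly connected in $G\setminus e$ if and only if they are strongly connected in $G\setminus\{u\}$ or in $G\setminus\{v\}$. Moreover, if $C_u$ and $C_v$ are the SCCs of $G\setminus e$ containing $u$ and $v$ respectively, then every SCC of $G\setminus e$ other than $C_u$ and $C_v$ is an SCC of both $G\setminus\{u\}$ and $G\setminus\{v\}$.
   Context: An edge is a strong bridge if its removal increases the number of strongly connected components (SCCs). $G\setminus e$ denotes $G$ with edge $e$ removed and $G\setminus\{x\}$ denotes $G$ with vertex $x$ and its incident edges removed. -}

module Defs where

open import Data.Nat using (ℕ; _<_)
open import Data.Fin using (Fin)
open import Data.Fin.Properties using (_≟_)
open import Data.Bool using (Bool; true; false; _∧_; not)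
open import Relation.Nullary.Decidable using (⌊_⌋)
open import Relation.Nullary using (¬_)
open import Relation.Binary.PropositionalEquality using (_≡_)
open import Data.Product using (Σ; _×_; ∃)
open import Function.Bundles using (_⇔_)

-- A (simple) directed graph on a subset of the vertex universe Fin n:
-- V says which vertices are present, E is the adjacency relation.
-- Only edges between present vertices are ever used.
record Digraph (n : ℕ) : Set where
  constructor digraph
  field
    V : Fin n → Bool
    E : Fin n → Fin n → Bool
open Digraph public

full : ∀ {n} → (Fin n → Fin n → Bool) → Digraph n
full E = digraph (λ _ → true) E

_∖edge_,_ : ∀ {n} → Digraph n → Fin n → Fin n → Digraph n
G ∖edge u , v = digraph (V G) (λ x y → E G x y ∧ not (⌊ x ≟ u ⌋ ∧ ⌊ y ≟ v ⌋))

_∖vertex_ : ∀ {n} → Digraph n → Fin n → Digraph n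
G ∖vertex x = digraph (λ y → V G y ∧ not ⌊ y ≟ x ⌋) (E G)

data Path {n} (G : Digraph n) : Fin n → Fin n → Set where
  here : ∀ {x} → V G x ≡ true → Path G x x
  step : ∀ {x y z} → V G x ≡ true → E G x y ≡ true → Path G y z → Path G x z

SC : ∀ {n} → Digraph n → Fin n → Fin n → Set
SC G x y = Path G x y × Path G y x

StronglyConnected : ∀ {n} → Digraph n → Set
StronglyConnected {n} G = (∀ x → V G x ≡ true) × (∀ (x y : Fin n) → SC G x y)

IsSCC : ∀ {n} → Digraph n → (Fin n → Set) → Set
IsSCC {n} G C = Σ (Fin n) λ x → V G x ≡ true × (∀ y → C y ⇔ SC G x y)

NumSCC : ∀ {n} → Digraph n → ℕ → Set
NumSCC {n} G k =
  Σ (Fin k → Fin n) λ r →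
    (∀ i → V G (r i) ≡ true) ×
    (∀ i j → SC G (r i) (r j) → i ≡ j) ×
    (∀ x → V G x ≡ true → ∃ λ i → SC G x (r i))

StrongBridge : ∀ {n} → Digraph n → Fin n → Fin n → Set
StrongBridge G u v =
  V G u ≡ true × V G v ≡ true × E G u v ≡ true ×
  (∀ k k' → NumSCC G k → NumSCC (G ∖edge u , v) k' → k < k')

-- Removing the strong bridge e = (u , v) leaves no path from u to v: otherwise every x would
-- still reach u (cut a path to u at its first visit of u) and be reached from v (start a path
-- from v at its last visit of v), so G ∖ e would stay strongly connected. Hence a cycle of
-- G ∖ e cannot meet both u and v, and a cycle through neither endpoint is a cycle of both
-- vertex-deleted graphs. An SCC avoiding z ∈ {u, v} is unaffected by deleting z, since all
-- its cycles avoid z, and G ∖ {z} is a subgraph of G ∖ e.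
module Submission where

open import Defs
open import Data.Nat using (ℕ)
open import Data.Nat.Properties using (<-irrefl)
open import Data.Fin using (Fin; zero)
open import Data.Fin.Properties using (_≟_)
open import Data.Bool using (true; false)
open import Data.Product using (_×_; _,_; proj₁; proj₂)
open import Data.Sum using (_⊎_; inj₁; inj₂; [_,_]; map)
open import Function using (id; _∘_)
open import Data.Empty using (⊥-elim)
open import Relation.Nullary using (¬_; yes; no)
open import Relation.Binary.PropositionalEquality using (_≡_; refl)
open import Function.Bundles using (_⇔_; mk⇔; Equivalence)

private
  variable
    n : ℕ
    G H K : Digraph n
    a b c u v w x y z : Fin n

∖vertex-present : ∀ H → V H y ≡ true → ¬ y ≡ z → V (H ∖vertex z) y ≡ true
∖vertex-present {y = y} {z = z} H Hy y≢z with y ≟ z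
... | yes y≡z = ⊥-elim (y≢z y≡z)
... | no _ rewrite Hy = refl

∖vertex-present⁻ : ∀ H z → V (H ∖vertex z) y ≡ true → V H y ≡ true × ¬ y ≡ z
∖vertex-present⁻ {y = y} H z Hy with V H y | y ≟ z
∖vertex-present⁻ H z () | false | _
∖vertex-present⁻ H z () | true  | yes _
... | true  | no y≢z = refl , y≢z

∖edge-keeps : ∀ G → E G a b ≡ true → ¬ (a ≡ u × b ≡ v) → E (G ∖edge u , v) a b ≡ true
∖edge-keeps {a = a} {b = b} {u = u} {v = v} G ab ab≢uv with a ≟ u | b ≟ v
... | yes a≡u | yes b≡v = ⊥-elim (ab≢uv (a≡u , b≡v))
... | yes _   | no _    rewrite ab = refl
... | no _    | _       rewrite ab = refl

∖edge-keeps⁻ : ∀ G u v → E (G ∖edge u , v) a b ≡ true → E G a b ≡ true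
∖edge-keeps⁻ {a = a} {b = b} G u v ab with E G a b
∖edge-keeps⁻ G u v () | false
... | true = refl

Path-source : Path H a b → V H a ≡ true
Path-source (here Ha)     = Ha
Path-source (step Ha _ _) = Ha

_++_ : Path H a b → Path H b c → Path H a c
here _        ++ q = q
step Ha ab p  ++ q = step Ha ab (p ++ q)

Path-avoid-or-through : ∀ z → Path H a b → Path (H ∖vertex z) a b ⊎ (Path H a z × Path H z b)
Path-avoid-or-through {H = H} z (here {a} Ha) with a ≟ z
... | yes refl = inj₂ (here Ha , here Ha)
... | no a≢z   = inj₁ (here (∖vertex-present H Ha a≢z))
Path-avoid-or-through {H = H} z (step {a} Ha ab p) with a ≟ z
... | yes refl = inj₂ (here Ha , step Ha ab p)
... | no a≢z with Path-avoid-or-through z p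
...   | inj₁ p′        = inj₁ (step (∖vertex-present H Ha a≢z) ab p′)
...   | inj₂ (bz , zc) = inj₂ (step Ha ab bz , zc)

SC-avoid-or-through : ∀ z → SC H x y → SC (H ∖vertex z) x y ⊎ SC H x z
SC-avoid-or-through z (p , q) with Path-avoid-or-through z p | Path-avoid-or-through z q
... | inj₁ p′        | inj₁ q′        = inj₁ (p′ , q′)
... | inj₂ (xz , zy) | _              = inj₂ (xz , zy ++ q)
... | inj₁ _         | inj₂ (yz , zx) = inj₂ (p ++ yz , zx)

-- A cycle meeting both u and v would give a path from u to v.
SC-avoid-one : ¬ Path H u v → SC H x y → SC (H ∖vertex u) x y ⊎ SC (H ∖vertex v) x y
SC-avoid-one {u = u} {v = v} ¬uv xy with SC-avoid-or-through u xy
... | inj₁ xy∖u = inj₁ xy∖u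
... | inj₂ xu with SC-avoid-or-through v xy
...   | inj₁ xy∖v = inj₂ xy∖v
...   | inj₂ xv   = ⊥-elim (¬uv (proj₂ xu ++ proj₁ xv))

Path-to-source : Path G x u → Path (G ∖edge u , w) x u
Path-to-source (here Gx) = here Gx
Path-to-source {G = G} {u = u} (step {a} Ga ab p) with a ≟ u
... | yes refl = here Ga
... | no a≢u   = step Ga (∖edge-keeps G ab (λ (a≡u , _) → a≢u a≡u)) (Path-to-source p)

Path-or-from-target : Path G a y → Path (G ∖edge w , v) a y ⊎ Path (G ∖edge w , v) v y
Path-or-from-target (here Ga) = inj₁ (here Ga)
Path-or-from-target {G = G} {v = v} (step {_} {b} Ga ab p) with Path-or-from-target p
... | inj₂ vy = inj₂ vy
... | inj₁ by with b ≟ v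
...   | yes refl = inj₂ by
...   | no b≢v   = inj₁ (step Ga (∖edge-keeps G ab (λ (_ , b≡v) → b≢v b≡v)) by)

Path-from-target : Path G v y → Path (G ∖edge w , v) v y
Path-from-target p = [ id , id ] (Path-or-from-target p)

infix 4 _⊆_

record _⊆_ (H K : Digraph n) : Set where
  field
    ⊆-V : V H x ≡ true → V K x ≡ true
    ⊆-E : V H x ≡ true → V H y ≡ true → E H x y ≡ true → E K x y ≡ true
open _⊆_

Path-mono : H ⊆ K → Path H a b → Path K a b
Path-mono H⊆K (here Ha)     = here (⊆-V H⊆K Ha)
Path-mono H⊆K (step Ha ab p) =
  step (⊆-V H⊆K Ha) (⊆-E H⊆K Ha (Path-source p) ab) (Path-mono H⊆K p)

SC-mono : H ⊆ K → SC H x y → SC K x y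
SC-mono H⊆K (p , q) = Path-mono H⊆K p , Path-mono H⊆K q

∖vertex-mono : H ⊆ K → H ∖vertex z ⊆ K ∖vertex z
∖vertex-mono {H = H} {K = K} {z = z} H⊆K = record
  { ⊆-V = λ Hx → let (Hx , x≢z) = ∖vertex-present⁻ H z Hx in ∖vertex-present K (⊆-V H⊆K Hx) x≢z
  ; ⊆-E = λ Hx Hy →
      ⊆-E H⊆K (proj₁ (∖vertex-present⁻ H z Hx)) (proj₁ (∖vertex-present⁻ H z Hy))
  }

∖edge-⊆ : G ∖edge u , v ⊆ G
∖edge-⊆ {G = G} {u = u} {v = v} = record { ⊆-V = id ; ⊆-E = λ _ _ → ∖edge-keeps⁻ G u v }

∖vertex-source-⊆ : G ∖vertex u ⊆ G ∖edge u , v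
∖vertex-source-⊆ {G = G} {u = u} = record
  { ⊆-V = λ Gx → proj₁ (∖vertex-present⁻ G u Gx)
  ; ⊆-E = λ Gx _ xy → ∖edge-keeps G xy (λ (x≡u , _) → proj₂ (∖vertex-present⁻ G u Gx) x≡u)
  }

∖vertex-target-⊆ : G ∖vertex v ⊆ G ∖edge u , v
∖vertex-target-⊆ {G = G} {v = v} = record
  { ⊆-V = λ Gx → proj₁ (∖vertex-present⁻ G v Gx)
  ; ⊆-E = λ _ Gy xy → ∖edge-keeps G xy (λ (_ , y≡v) → proj₂ (∖vertex-present⁻ G v Gy) y≡v)
  }

-- A cycle through a vertex of C and through z would put z in C.
IsSCC-∖vertex : {C : Fin n → Set} → H ∖vertex z ⊆ K → K ⊆ H →
                IsSCC H C → ¬ C z → IsSCC K C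
IsSCC-∖vertex {H = H} {z = z} {K = K} {C = C} H∖z⊆K K⊆H (x , Hx , C⇔) ¬Cz =
  x , ⊆-V H∖z⊆K (∖vertex-present H Hx x≢z) , λ y → mk⇔ (to y) (from y)
  where
  in-C : ∀ {y} → SC H x y → C y
  in-C = Equivalence.from (C⇔ _)
  x≢z : ¬ x ≡ z
  x≢z refl = ¬Cz (in-C (here Hx , here Hx))
  to : ∀ y → C y → SC K x y
  to y Cy with SC-avoid-or-through z (Equivalence.to (C⇔ y) Cy)
  ... | inj₁ xy∖z = SC-mono H∖z⊆K xy∖z
  ... | inj₂ xz   = ⊥-elim (¬Cz (in-C xz))
  from : ∀ y → SC K x y → C y
  from y xy = in-C (SC-mono K⊆H xy)

NumSCC-one : V H z ≡ true → (∀ x → V H x ≡ true → SC H x z) → NumSCC H 1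
NumSCC-one Hz all-z =
  (λ _ → _) , (λ _ → Hz) , (λ { zero zero _ → refl }) , λ x Hx → zero , all-z x Hx

StrongBridge-cuts : StronglyConnected G → StrongBridge G u v → ¬ Path (G ∖edge u , v) u v
StrongBridge-cuts {G = G} (_ , G-sc) (Gu , _ , _ , more-SCCs) uv =
  <-irrefl refl (more-SCCs 1 1 (NumSCC-one Gu λ x _ → G-sc x _) (NumSCC-one Gu reaches-u))
  where
  reaches-u : ∀ x → V G x ≡ true → SC (G ∖edge _ , _) x _
  reaches-u x _ = Path-to-source (proj₁ (G-sc x _)) , uv ++ Path-from-target (proj₁ (G-sc _ x))

lemma15 : ∀ {n} (G : Digraph n) (u v : Fin n) →
    StronglyConnected G → StrongBridge G u v →
    (∀ x y → SC (G ∖edge u , v) x y ⇔ (SC (G ∖vertex u) x y ⊎ SC (G ∖vertex v) x y))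
    × (∀ (C : Fin n → Set) → IsSCC (G ∖edge u , v) C → ¬ C u → ¬ C v →
    IsSCC (G ∖vertex u) C × IsSCC (G ∖vertex v) C)
lemma15 G u v G-sc bridge = SC-characterisation , SCC-preserved
  where
  ¬uv : ¬ Path (G ∖edge u , v) u v
  ¬uv = StrongBridge-cuts G-sc bridge
  SC-characterisation : ∀ x y → SC (G ∖edge u , v) x y ⇔ (SC (G ∖vertex u) x y ⊎ SC (G ∖vertex v) x y)
  SC-characterisation x y = mk⇔
    (map (SC-mono (∖vertex-mono ∖edge-⊆)) (SC-mono (∖vertex-mono ∖edge-⊆)) ∘ SC-avoid-one ¬uv)
    [ SC-mono ∖vertex-source-⊆ , SC-mono ∖vertex-target-⊆ ]
  SCC-preserved : ∀ C → IsSCC (G ∖edge u , v) C → ¬ C u → ¬ C v →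
                  IsSCC (G ∖vertex u) C × IsSCC (G ∖vertex v) C
  SCC-preserved C C-scc ¬Cu ¬Cv =
    IsSCC-∖vertex (∖vertex-mono ∖edge-⊆) ∖vertex-source-⊆ C-scc ¬Cu ,
    IsSCC-∖vertex (∖vertex-mono ∖edge-⊆) ∖vertex-target-⊆ C-scc ¬Cv
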